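{- For every positive integer $m$, $\nu(m)\leq 2^{2^{3m}-1}-1$.
   Context: A matroid on a finite set $S$ is a family $\mathcal{M}$ of subsets of $S$ with $\emptyset\in\mathcal{M}$, closed under subsets, such that for every $A\subseteq S$ all maximal members of $\mathcal{M}$ contained in $A$ have the same cardinality. For a finite simple graph $G=(V,E)$, $M(G)$ is the family of all matchings (sets of pairwise disjoint edges) of $G$, and $\mu(G)$ is the minimum $m\in\mathbb{N}$ such that $M(G)$ is the intersection $\mathcal{M}_1\cap\dots\cap\mathcal{M}_m$ of $m$ matroids on $E$. For $n\in\mathbb{N}$, $\mu(n)=\max\{\mu(G): G \text{ a finite simple graph with } |V|\le n\}$, and for $m\in\mathbb{N}$, $\nu(m)=\sup\{n\in\mathbb{N}:\mu(n)\le m\}$. -}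

module Defs where

open import Level using (0ℓ)
open import Data.Nat using (ℕ; _≤_)
open import Data.Fin using (Fin)
open import Data.Fin.Subset using (Subset; ⊥; _⊆_; _∈_; ∣_∣)
open import Data.Product using (Σ; _×_; _,_; proj₁; proj₂)
open import Data.Sum using (_⊎_)
open import Relation.Binary.PropositionalEquality using (_≡_; _≢_)
open import Function.Bundles using (_⇔_)

Family : ℕ → Set₁
Family e = Subset e → Set

MaximalIn : ∀ {e} → Family e → Subset e → Subset e → Set
MaximalIn 𝓜 A X =
  X ⊆ A × 𝓜 X × (∀ Y → X ⊆ Y → Y ⊆ A → 𝓜 Y → Y ⊆ X)

record IsMatroid {e : ℕ} (𝓜 : Family e) : Set where
  field
    empty∈   : 𝓜 ⊥
    downward : ∀ X Y → Y ⊆ X → 𝓜 X → 𝓜 Y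
    equicard : ∀ A X Y → MaximalIn 𝓜 A X → MaximalIn 𝓜 A Y → ∣ X ∣ ≡ ∣ Y ∣

SameUnordered : ∀ {k} → Fin k × Fin k → Fin k × Fin k → Set
SameUnordered (u , v) (u' , v') = (u ≡ u' × v ≡ v') ⊎ (u ≡ v' × v ≡ u')

record SimpleGraph (k e : ℕ) : Set where
  field
    ends      : Fin e → Fin k × Fin k
    loopless  : ∀ a → proj₁ (ends a) ≢ proj₂ (ends a)
    noMulti   : ∀ a b → SameUnordered (ends a) (ends b) → a ≡ b

Incident : ∀ {k e} → SimpleGraph k e → Fin k → Fin e → Set
Incident G v a = (v ≡ proj₁ (SimpleGraph.ends G a)) ⊎ (v ≡ proj₂ (SimpleGraph.ends G a))

Matching : ∀ {k e} → SimpleGraph k e → Family e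
Matching G X = ∀ a b → a ∈ X → b ∈ X → a ≢ b → ∀ v → Incident G v a → Incident G v b → Data.Empty.⊥
  where import Data.Empty

IsIntersectionOf : ∀ {e j} → Family e → (Fin j → Family e) → Set
IsIntersectionOf {e} F 𝓜 = ∀ (X : Subset e) → F X ⇔ (∀ i → 𝓜 i X)

μG≤ : ∀ {k e} → SimpleGraph k e → ℕ → Set₁
μG≤ {k} {e} G m =
  Σ ℕ λ j → j ≤ m × Σ (Fin j → Family e) λ 𝓜 →
    (∀ i → IsMatroid (𝓜 i)) × IsIntersectionOf (Matching G) 𝓜

μ≤ : ℕ → ℕ → Set₁
μ≤ n m = ∀ k e → k ≤ n → (G : SimpleGraph k e) → μG≤ G m

-- ν(m) ≤ N : every n with μ(n) ≤ m satisfies n ≤ N (N is an upper bound of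
-- the set whose supremum is ν(m)).
ν≤ : ℕ → ℕ → Set₁
ν≤ m N = ∀ n → μ≤ n m → n ≤ N

-- Colour each edge xy (x < y) of the complete graph Kₙ by the set of matroids 𝓜ᵢ in which
-- xy is parallel to some edge yz with y < z; then colour each vertex x by the set of colours
-- of its edges xy with x < y.  Two consecutive edges xy, yz are dependent in some 𝓜ᵢ, since
-- they do not form a matching; parallelism in a matroid is transitive and disjoint edges are
-- never parallel, so xy and yz get different colours, and hence all vertices get different
-- colours.  Thus n ≤ 2 ^ 2 ^ j whenever M(Kₙ) is an intersection of j matroids.
module Submission where

open import Defs
open import Data.Nat using (ℕ; _≤_; _∸_; _^_; _*_)
open import Data.Nat as ℕ using (zero; suc; _+_; _<_; z≤n; s≤s)
import Data.Nat.Properties as ℕ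
open import Data.Bool using (Bool)
open import Data.Fin as Fin using (Fin; splitAt; join; funToFin; _↑ˡ_; _↑ʳ_)
import Data.Fin.Properties as Fin
open import Data.Fin.Subset using (Subset; ⁅_⁆; _∪_; _∈_; _⊆_; ∣_∣)
open import Data.Fin.Subset.Properties
  using (x∈⁅x⁆; x∈⁅y⁆⇒x≡y; ∣⁅x⁆∣≡1; x∈p∪q⁺; x∈p∪q⁻; p⊂q⇒∣p∣<∣q∣)
open import Data.Product using (∃; ∃₂; _×_; _,_; proj₁; proj₂)
open import Data.Sum using (_⊎_; inj₁; inj₂; map₂)
open import Data.Empty using (⊥; ⊥-elim)
open import Function using (_∘_; Injective; Inverse)
open import Function.Bundles using (Equivalence)
open import Relation.Binary using (tri<; tri≈; tri>)
open import Relation.Binary.PropositionalEquality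
  using (_≡_; _≢_; _≗_; refl; sym; trans; cong; cong₂; subst; subst₂; module ≡-Reasoning)
open import Relation.Nullary using (¬_; Dec; yes; no; does; _×-dec_; ¬?)
open import Relation.Nullary.Decidable using (decidable-stable; ¬¬-excluded-middle; dec-true)

∀¬¬⇒¬¬∀ : ∀ {k} {P : Fin k → Set} → (∀ x → ¬ ¬ P x) → ¬ ¬ (∀ x → P x)
∀¬¬⇒¬¬∀ {zero}  h ¬∀ = ¬∀ (λ ())
∀¬¬⇒¬¬∀ {suc k} h ¬∀ =
  h Fin.zero λ p₀ → ∀¬¬⇒¬¬∀ (h ∘ Fin.suc) λ ps → ¬∀ λ { Fin.zero → p₀ ; (Fin.suc x) → ps x }

does-≡⇒→ : ∀ {A B : Set} (a? : Dec A) (b? : Dec B) → does a? ≡ does b? → A → B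
does-≡⇒→ a? (yes b) _  _ = b
does-≡⇒→ a? (no _)  eq a with () ← trans (sym (dec-true a? a)) eq

<⇒≤∸1 : ∀ {m n} → m < n → m ≤ n ∸ 1
<⇒≤∸1 (s≤s m≤n) = m≤n

code : ∀ {j} → (Fin j → Bool) → Fin (2 ^ j)
code f = funToFin (Inverse.from Fin.2↔Bool ∘ f)

code-injective : ∀ {j} {f g : Fin j → Bool} → code f ≡ code g → f ≗ g
code-injective {f = f} {g} eq i = begin
  f i                                       ≡⟨ sym (from-to (f i)) ⟩
  to (from (f i))                           ≡⟨ cong to (sym (Fin.finToFun-funToFin (from ∘ f) i)) ⟩
  to (Fin.finToFun (funToFin (from ∘ f)) i) ≡⟨ cong (λ c → to (Fin.finToFun c i)) eq ⟩
  to (Fin.finToFun (funToFin (from ∘ g)) i) ≡⟨ cong to (Fin.finToFun-funToFin (from ∘ g) i) ⟩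
  to (from (g i))                           ≡⟨ from-to (g i) ⟩
  g i                                       ∎
  where
  open ≡-Reasoning
  open Inverse Fin.2↔Bool using (to; from) renaming (strictlyInverseˡ to from-to)

pair : ∀ {e} → Fin e → Fin e → Subset e
pair a b = ⁅ a ⁆ ∪ ⁅ b ⁆

triple : ∀ {e} → Fin e → Fin e → Fin e → Subset e
triple a b c = pair a b ∪ ⁅ c ⁆

module _ {e : ℕ} where

  ∈pair⁺ˡ : ∀ (a b : Fin e) → a ∈ pair a b
  ∈pair⁺ˡ a b = x∈p∪q⁺ (inj₁ (x∈⁅x⁆ a))

  ∈pair⁺ʳ : ∀ (a b : Fin e) → b ∈ pair a b
  ∈pair⁺ʳ a b = x∈p∪q⁺ (inj₂ (x∈⁅x⁆ b))

  ∈pair⁻ : ∀ {a b z : Fin e} → z ∈ pair a b → z ≡ a ⊎ z ≡ b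
  ∈pair⁻ {a} {b} z∈ with x∈p∪q⁻ ⁅ a ⁆ ⁅ b ⁆ z∈
  ... | inj₁ z∈a = inj₁ (x∈⁅y⁆⇒x≡y a z∈a)
  ... | inj₂ z∈b = inj₂ (x∈⁅y⁆⇒x≡y b z∈b)

  pair⊆ : ∀ {a b : Fin e} {Y : Subset e} → a ∈ Y → b ∈ Y → pair a b ⊆ Y
  pair⊆ a∈Y b∈Y z∈ with ∈pair⁻ z∈
  ... | inj₁ refl = a∈Y
  ... | inj₂ refl = b∈Y

  ∈triple⁻ : ∀ {a b c z : Fin e} → z ∈ triple a b c → z ≡ a ⊎ z ≡ b ⊎ z ≡ c
  ∈triple⁻ {a} {b} {c} z∈ with x∈p∪q⁻ (pair a b) ⁅ c ⁆ z∈
  ... | inj₁ z∈ab = map₂ inj₁ (∈pair⁻ z∈ab)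
  ... | inj₂ z∈c  = inj₂ (inj₂ (x∈⁅y⁆⇒x≡y c z∈c))

  triple⊇ : ∀ {a b c z : Fin e} → z ≡ a ⊎ z ≡ b ⊎ z ≡ c → z ∈ triple a b c
  triple⊇ {a} {b} (inj₁ refl)        = x∈p∪q⁺ (inj₁ (∈pair⁺ˡ a b))
  triple⊇ {a} {b} (inj₂ (inj₁ refl)) = x∈p∪q⁺ (inj₁ (∈pair⁺ʳ a b))
  triple⊇ {c = c} (inj₂ (inj₂ refl)) = x∈p∪q⁺ (inj₂ (x∈⁅x⁆ c))

  ∣pair∣>1 : ∀ {a b : Fin e} → a ≢ b → 1 < ∣ pair a b ∣
  ∣pair∣>1 {a} {b} a≢b = subst (_< ∣ pair a b ∣) (∣⁅x⁆∣≡1 a)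
    (p⊂q⇒∣p∣<∣q∣ ((λ z∈a → x∈p∪q⁺ (inj₁ z∈a)) , b , ∈pair⁺ʳ a b ,
                   λ b∈a → a≢b (sym (x∈⁅y⁆⇒x≡y a b∈a))))

module _ {e : ℕ} {𝓜 : Family e} (matroid : IsMatroid 𝓜) where
  open IsMatroid matroid

  dependent-⊆ : ∀ {X Y} → X ⊆ Y → ¬ 𝓜 X → ¬ 𝓜 Y
  dependent-⊆ {X} {Y} X⊆Y ¬X Y∈ = ¬X (downward Y X X⊆Y Y∈)

  -- Inside {f, g, h}, both {f, h} and {g} would be maximal independent sets.
  parallel-trans : ∀ {f g h} → 𝓜 ⁅ g ⁆ → f ≢ h →
                   ¬ 𝓜 (pair f g) → ¬ 𝓜 (pair g h) → ¬ 𝓜 (pair f h)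
  parallel-trans {f} {g} {h} g∈ f≢h ¬fg ¬gh fh∈ =
    ℕ.<-irrefl (sym (trans (equicard (triple f g h) (pair f h) ⁅ g ⁆ fh-maximal g-maximal) (∣⁅x⁆∣≡1 g)))
               (∣pair∣>1 f≢h)
    where
    fh-maximal : MaximalIn 𝓜 (triple f g h) (pair f h)
    fh-maximal = pair⊆ (triple⊇ (inj₁ refl)) (triple⊇ (inj₂ (inj₂ refl))) , fh∈ ,
      λ Y fh⊆Y Y⊆fgh Y∈ {z} z∈Y → case Y fh⊆Y Y∈ z∈Y (∈triple⁻ (Y⊆fgh z∈Y))
      where
      case : ∀ Y → pair f h ⊆ Y → 𝓜 Y → ∀ {z} → z ∈ Y → z ≡ f ⊎ z ≡ g ⊎ z ≡ h → z ∈ pair f h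
      case Y fh⊆Y Y∈ z∈Y (inj₁ refl)        = ∈pair⁺ˡ f h
      case Y fh⊆Y Y∈ z∈Y (inj₂ (inj₂ refl)) = ∈pair⁺ʳ f h
      case Y fh⊆Y Y∈ z∈Y (inj₂ (inj₁ refl)) =
        ⊥-elim (dependent-⊆ (pair⊆ (fh⊆Y (∈pair⁺ˡ f h)) z∈Y) ¬fg Y∈)
    g-maximal : MaximalIn 𝓜 (triple f g h) ⁅ g ⁆
    g-maximal = (λ z∈g → triple⊇ (inj₂ (inj₁ (x∈⁅y⁆⇒x≡y g z∈g)))) , g∈ ,
      λ Y g⊆Y Y⊆fgh Y∈ {z} z∈Y → case Y (g⊆Y (x∈⁅x⁆ g)) Y∈ z∈Y (∈triple⁻ (Y⊆fgh z∈Y))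
      where
      case : ∀ Y → g ∈ Y → 𝓜 Y → ∀ {z} → z ∈ Y → z ≡ f ⊎ z ≡ g ⊎ z ≡ h → z ∈ ⁅ g ⁆
      case Y g∈Y Y∈ z∈Y (inj₂ (inj₁ refl)) = x∈⁅x⁆ g
      case Y g∈Y Y∈ z∈Y (inj₁ refl)        = ⊥-elim (dependent-⊆ (pair⊆ z∈Y g∈Y) ¬fg Y∈)
      case Y g∈Y Y∈ z∈Y (inj₂ (inj₂ refl)) = ⊥-elim (dependent-⊆ (pair⊆ g∈Y z∈Y) ¬gh Y∈)

module _ {k e : ℕ} (G : SimpleGraph k e) where

  Disjoint : Fin e → Fin e → Set
  Disjoint a b = ∀ v → Incident G v a → Incident G v b → ⊥

  singleton-matching : ∀ a → Matching G ⁅ a ⁆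
  singleton-matching a b c b∈ c∈ b≢c _ _ _ = b≢c (trans (x∈⁅y⁆⇒x≡y a b∈) (sym (x∈⁅y⁆⇒x≡y a c∈)))

  disjoint⇒matching : ∀ {a b} → Disjoint a b → Matching G (pair a b)
  disjoint⇒matching disjoint c d c∈ d∈ c≢d v v∈c v∈d with ∈pair⁻ c∈ | ∈pair⁻ d∈
  ... | inj₁ refl | inj₁ refl = c≢d refl
  ... | inj₁ refl | inj₂ refl = disjoint v v∈c v∈d
  ... | inj₂ refl | inj₁ refl = disjoint v v∈d v∈c
  ... | inj₂ refl | inj₂ refl = c≢d refl

  adjacent⇒¬matching : ∀ {a b v} → a ≢ b → Incident G v a → Incident G v b → ¬ Matching G (pair a b)
  adjacent⇒¬matching {a} {b} {v} a≢b v∈a v∈b matching =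
    matching a b (∈pair⁺ˡ a b) (∈pair⁺ʳ a b) a≢b v v∈a v∈b

-- P i x y z relates the consecutive edges xy and yz (x < y < z) in the i-th way.
module ChainFree {n j : ℕ} (P : Fin j → Fin n → Fin n → Fin n → Set)
  (P? : ∀ i x y z → Dec (P i x y z))
  (covering : ∀ {x y z} → x Fin.< y → y Fin.< z → ¬ (∀ i → ¬ P i x y z))
  (chain-free : ∀ {i x y z w} → x Fin.< y → y Fin.< z → z Fin.< w →
                P i x y z → P i y z w → ⊥) where

  continues? : ∀ i x y → Dec (∃ λ z → y Fin.< z × P i x y z)
  continues? i x y = Fin.any? λ z → (y Fin.<? z) ×-dec P? i x y z

  edgeColour : Fin n → Fin n → Fin (2 ^ j)
  edgeColour x y = code λ i → does (continues? i x y)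

  edgeColour-proper : ∀ {x y z} → x Fin.< y → y Fin.< z → edgeColour x y ≢ edgeColour y z
  edgeColour-proper {x} {y} {z} x<y y<z same =
    let i , ¬¬Pxyz   = Fin.¬∀⟶∃¬ j (λ i → ¬ P i x y z) (λ i → ¬? (P? i x y z)) (covering x<y y<z)
        Pxyz         = decidable-stable (P? i x y z) ¬¬Pxyz
        w , z<w , Pyzw = does-≡⇒→ (continues? i x y) (continues? i y z) (code-injective same i)
                           (z , y<z , Pxyz)
    in chain-free x<y y<z z<w Pxyz Pyzw

  outgoing? : ∀ x c → Dec (∃ λ y → x Fin.< y × edgeColour x y ≡ c)
  outgoing? x c = Fin.any? λ y → (x Fin.<? y) ×-dec (edgeColour x y Fin.≟ c)

  vertexColour : Fin n → Fin (2 ^ 2 ^ j)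
  vertexColour x = code λ c → does (outgoing? x c)

  vertexColour-< : ∀ {x y} → x Fin.< y → vertexColour x ≢ vertexColour y
  vertexColour-< {x} {y} x<y same =
    let z , y<z , colour≡ = does-≡⇒→ (outgoing? x (edgeColour x y)) (outgoing? y (edgeColour x y))
                              (code-injective same (edgeColour x y)) (y , x<y , refl)
    in edgeColour-proper x<y y<z (sym colour≡)

  vertexColour-injective : Injective _≡_ _≡_ vertexColour
  vertexColour-injective {x} {y} same with Fin.<-cmp x y
  ... | tri< x<y _ _ = ⊥-elim (vertexColour-< x<y same)
  ... | tri≈ _ x≡y _ = x≡y
  ... | tri> _ _ y<x = ⊥-elim (vertexColour-< y<x (sym same))

  n≤2^2^j : n ≤ 2 ^ 2 ^ j
  n≤2^2^j = Fin.injective⇒≤ vertexColour-injective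

pairCount : ℕ → ℕ
pairCount zero    = 0
pairCount (suc n) = pairCount n + n

-- The pairs x < y in Fin (suc n) are the shifted pairs of Fin n, followed by the pairs (0, y).
orderedPair : ∀ n → Fin (pairCount n) → Fin n × Fin n
orderedPair′ : ∀ n → Fin (pairCount n) ⊎ Fin n → Fin (suc n) × Fin (suc n)
orderedPair zero    ()
orderedPair (suc n) a = orderedPair′ n (splitAt (pairCount n) a)
orderedPair′ n (inj₁ a) = Fin.suc (proj₁ (orderedPair n a)) , Fin.suc (proj₂ (orderedPair n a))
orderedPair′ n (inj₂ y) = Fin.zero , Fin.suc y

orderedPair-< : ∀ n a → proj₁ (orderedPair n a) Fin.< proj₂ (orderedPair n a)
orderedPair′-< : ∀ n s → proj₁ (orderedPair′ n s) Fin.< proj₂ (orderedPair′ n s)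
orderedPair-< (suc n) a = orderedPair′-< n (splitAt (pairCount n) a)
orderedPair′-< n (inj₁ a) = s≤s (orderedPair-< n a)
orderedPair′-< n (inj₂ y) = s≤s z≤n

orderedPair-injective : ∀ n → Injective _≡_ _≡_ (orderedPair n)
orderedPair′-injective : ∀ n → Injective _≡_ _≡_ (orderedPair′ n)
orderedPair-injective (suc n) {a} {b} eq = begin
  a                                              ≡⟨ Fin.join-splitAt (pairCount n) n a ⟨
  join (pairCount n) n (splitAt (pairCount n) a) ≡⟨ cong (join (pairCount n) n) (orderedPair′-injective n eq) ⟩
  join (pairCount n) n (splitAt (pairCount n) b) ≡⟨ Fin.join-splitAt (pairCount n) n b ⟩
  b                                              ∎
  where open ≡-Reasoning
orderedPair′-injective n {inj₁ a} {inj₁ b} eq =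
  cong inj₁ (orderedPair-injective n (cong₂ _,_ (Fin.suc-injective (cong proj₁ eq))
                                                (Fin.suc-injective (cong proj₂ eq))))
orderedPair′-injective n {inj₂ y} {inj₂ .y} refl = refl
orderedPair′-injective n {inj₁ a} {inj₂ y} ()
orderedPair′-injective n {inj₂ y} {inj₁ a} ()

orderedPair-surjective : ∀ n {x y : Fin n} → x Fin.< y → ∃ λ a → orderedPair n a ≡ (x , y)
orderedPair-surjective (suc n) {Fin.zero} {Fin.suc y} _ =
  pairCount n ↑ʳ y , cong (orderedPair′ n) (Fin.splitAt-↑ʳ (pairCount n) n y)
orderedPair-surjective (suc n) {Fin.suc x} {Fin.suc y} (s≤s x<y) =
  let a , a↦xy = orderedPair-surjective n x<y
  in a ↑ˡ n , (begin
    orderedPair′ n (splitAt (pairCount n) (a ↑ˡ n)) ≡⟨ cong (orderedPair′ n) (Fin.splitAt-↑ˡ (pairCount n) a n) ⟩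
    orderedPair′ n (inj₁ a)                         ≡⟨ cong (λ (x , y) → Fin.suc x , Fin.suc y) a↦xy ⟩
    Fin.suc x , Fin.suc y                           ∎)
  where open ≡-Reasoning

complete : ∀ n → SimpleGraph n (pairCount n)
complete n = record
  { ends     = orderedPair n
  ; loopless = λ a ends≡ → Fin.<-irrefl ends≡ (orderedPair-< n a)
  ; noMulti  = noMulti
  }
  where
  noMulti : ∀ a b → SameUnordered (orderedPair n a) (orderedPair n b) → a ≡ b
  noMulti a b (inj₁ (≡₁ , ≡₂)) = orderedPair-injective n (cong₂ _,_ ≡₁ ≡₂)
  noMulti a b (inj₂ (≡₁ , ≡₂)) = ⊥-elim (Fin.<-asym
    (subst₂ Fin._<_ ≡₁ ≡₂ (orderedPair-< n a)) (orderedPair-< n b))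

incident-between : ∀ {n v} a → Incident (complete n) v a →
                   proj₁ (orderedPair n a) Fin.≤ v × v Fin.≤ proj₂ (orderedPair n a)
incident-between {n} a (inj₁ refl) = Fin.≤-refl , ℕ.<⇒≤ (orderedPair-< n a)
incident-between {n} a (inj₂ refl) = ℕ.<⇒≤ (orderedPair-< n a) , Fin.≤-refl

module CompleteGraph {n j : ℕ} (𝓜 : Fin j → Family (pairCount n))
  (matroid : ∀ i → IsMatroid (𝓜 i))
  (represents : IsIntersectionOf (Matching (complete n)) 𝓜) where

  matching⇒independent : ∀ {X} → Matching (complete n) X → ∀ i → 𝓜 i X
  matching⇒independent {X} = Equivalence.to (represents X)

  Parallel : Fin j → Fin n → Fin n → Fin n → Set
  Parallel i x y z = ∃₂ λ a b → orderedPair n a ≡ (x , y) × orderedPair n b ≡ (y , z) × ¬ 𝓜 i (pair a b)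

  covering : ∀ {x y z} → x Fin.< y → y Fin.< z → ¬ (∀ i → ¬ Parallel i x y z)
  covering {x} {y} {z} x<y y<z noneParallel =
    let a , a↦xy = orderedPair-surjective n x<y
        b , b↦yz = orderedPair-surjective n y<z
        a≢b : a ≢ b
        a≢b a≡b = Fin.<-irrefl (cong proj₁ (trans (sym a↦xy) (trans (cong (orderedPair n) a≡b) b↦yz))) x<y
    in ∀¬¬⇒¬¬∀ (λ i dependent → noneParallel i (a , b , a↦xy , b↦yz , dependent))
         (adjacent⇒¬matching (complete n) a≢b (inj₂ (cong proj₂ (sym a↦xy))) (inj₁ (cong proj₁ (sym b↦yz)))
          ∘ Equivalence.from (represents (pair a b)))

  chain-free : ∀ {i x y z w} → x Fin.< y → y Fin.< z → z Fin.< w →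
               Parallel i x y z → Parallel i y z w → ⊥
  chain-free {i} x<y y<z z<w (a , b , a↦xy , b↦yz , ¬ab) (b′ , c , b′↦yz , c↦zw , ¬b′c)
    with refl ← orderedPair-injective n (trans b↦yz (sym b′↦yz)) =
    parallel-trans (matroid i) (matching⇒independent (singleton-matching (complete n) b) i) a≢c ¬ab ¬b′c
      (matching⇒independent (disjoint⇒matching (complete n) disjoint) i)
    where
    separated : proj₂ (orderedPair n a) Fin.< proj₁ (orderedPair n c)
    separated = subst₂ Fin._<_ (cong proj₂ (sym a↦xy)) (cong proj₁ (sym c↦zw)) y<z
    a≢c : a ≢ c
    a≢c refl = Fin.<-asym separated (orderedPair-< n a)
    disjoint : Disjoint (complete n) a c
    disjoint v v∈a v∈c =
      ℕ.<-irrefl refl (ℕ.≤-<-trans (proj₂ (incident-between a v∈a))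
                        (ℕ.<-≤-trans separated (proj₁ (incident-between c v∈c))))

  -- Membership in 𝓜 i need not be decidable, but the goal is, so Parallel may be assumed decidable.
  n≤2^2^j : n ≤ 2 ^ 2 ^ j
  n≤2^2^j = decidable-stable (n ℕ.≤? 2 ^ 2 ^ j) λ n≰ →
    ∀¬¬⇒¬¬∀ (λ i → ∀¬¬⇒¬¬∀ λ x → ∀¬¬⇒¬¬∀ λ y → ∀¬¬⇒¬¬∀ λ z → ¬¬-excluded-middle)
      λ Parallel? → n≰ (ChainFree.n≤2^2^j Parallel Parallel? covering chain-free)

2^2^j≤2^[2^[3m]∸1]∸1 : ∀ {m j} → 1 ≤ m → j ≤ m → 2 ^ 2 ^ j ≤ 2 ^ (2 ^ (3 * m) ∸ 1) ∸ 1
2^2^j≤2^[2^[3m]∸1]∸1 {m} {j} 1≤m j≤m = <⇒≤∸1 (begin-strict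
  2 ^ 2 ^ j             ≤⟨ ℕ.^-monoʳ-≤ 2 (ℕ.^-monoʳ-≤ 2 j≤m) ⟩
  2 ^ 2 ^ m             <⟨ ℕ.^-monoʳ-< 2 (s≤s (s≤s z≤n)) (<⇒≤∸1 2+2^m≤2^[3m]) ⟩
  2 ^ (2 ^ (3 * m) ∸ 1) ∎)
  where
  open ℕ.≤-Reasoning
  1+m≤3m : suc m ≤ 3 * m
  1+m≤3m = begin
    suc m             ≡⟨ ℕ.+-comm 1 m ⟩
    m + 1             ≤⟨ ℕ.+-monoʳ-≤ m (ℕ.≤-trans 1≤m (ℕ.m≤m+n m (m + 0))) ⟩
    3 * m             ∎
  2+2^m≤2^[3m] : 2 + 2 ^ m ≤ 2 ^ (3 * m)
  2+2^m≤2^[3m] = begin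
    2 + 2 ^ m         ≤⟨ ℕ.+-monoˡ-≤ (2 ^ m) (ℕ.^-monoʳ-≤ 2 1≤m) ⟩
    2 ^ m + 2 ^ m     ≤⟨ ℕ.+-monoʳ-≤ (2 ^ m) (ℕ.m≤m+n (2 ^ m) 0) ⟩
    2 ^ suc m         ≤⟨ ℕ.^-monoʳ-≤ 2 1+m≤3m ⟩
    2 ^ (3 * m)       ∎

theorem4 : (m : ℕ) → 1 ≤ m → ν≤ m (2 ^ (2 ^ (3 * m) ∸ 1) ∸ 1)
theorem4 m 1≤m n μ[n]≤m =
  let j , j≤m , 𝓜 , matroid , represents = μ[n]≤m n (pairCount n) ℕ.≤-refl (complete n)
  in ℕ.≤-trans (CompleteGraph.n≤2^2^j 𝓜 matroid represents) (2^2^j≤2^[2^[3m]∸1]∸1 1≤m j≤m)
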